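{- Let $G=(V,E)$ be a connected, undirected, unweighted graph, $R\subseteq V$ a set of landmarks, $H=(R,\delta_H)$ the highway, and $L$ the labelling constructed by Algorithm 1 (described in the context). Let $r\in R$ and $v\in V\setminus R$. If $L(v)$ contains no entry for $r$, then there exists a landmark $r_j\in R$ such that $(r_j,\delta_L(r_j,v))\in L(v)$ and $d_G(r,v)=\delta_L(r_j,v)+\delta_H(r,r_j)$.
   Context: $d_G(u,v)$ denotes the shortest-path distance in $G$. A highway is a pair $H=(R,\delta_H)$ with $\delta_H(r_1,r_2)=d_G(r_1,r_2)$ for all $r_1,r_2\in R$. A distance labelling assigns to each $v\in V\setminus R$ a label $L(v)$, a set of entries $(r,\delta_L(r,v))$ with $r\in R$ and $\delta_L(r,v)=d_G(r,v)$. Algorithm 1: initialise $L(v)=\emptyset$ for all $v\in V\setminus R$. For each $r_i\in R$ (in any order) run the following pruned BFS, in which each vertex is visited at most once and the root $r_i$ is visited at depth $0$. Keep two queues $\mathcal{Q}_{label}=\{r_i\}$ and $\mathcal{Q}_{prune}=\emptyset$ and set $n=0$. While $\mathcal{Q}_{label}$ contains vertices of depth $n$: (i) for each $u\in\mathcal{Q}_{label}$ at depth $n$ and each unvisited neighbour $v$ of $u$ (which becomes visited at depth $n+1$): if $v\in R$, enqueue $v$ to $\mathcal{Q}_{prune}$; otherwise enqueue $v$ to $\mathcal{Q}_{label}$ and add $(r_i,n+1)$ to $L(v)$; (ii) set $n\gets n+1$; (iii) for each $v\in\mathcal{Q}_{prune}$ at depth $n$, mark every unvisited neighbour of $v$ as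 visited at depth $n+1$ and enqueue it to $\mathcal{Q}_{prune}$ (no label is added). The output is $L$. -}

module Defs where

open import Data.Nat using (ℕ; zero; suc; _≤_)
open import Data.Bool using (Bool; true; false; _∧_; _∨_; not; if_then_else_)
open import Data.Fin using (Fin; _≟_)
open import Data.List using (List; []; _∷_; concatMap; allFin)
open import Data.Bool.ListAction using (any)
open import Data.Maybe using (Maybe; just; nothing; maybe)
open import Data.Product using (_×_; _,_; ∃)
open import Relation.Nullary using (does)
open import Relation.Binary.PropositionalEquality using (_≡_)

record Graph (n : ℕ) : Set where
  field
    adj : Fin n → Fin n → Bool
    sym : ∀ u v → adj u v ≡ adj v u
open Graph public

data Walk {n : ℕ} (G : Graph n) : Fin n → Fin n → ℕ → Set where
  here : ∀ {u} → Walk G u u 0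
  step : ∀ {u w v k} → adj G u w ≡ true → Walk G w v k → Walk G u v (suc k)

IsDist : ∀ {n} → Graph n → Fin n → Fin n → ℕ → Set
IsDist G u v k = Walk G u v k × (∀ m → Walk G u v m → k ≤ m)

Connected : ∀ {n} → Graph n → Set
Connected G = ∀ u v → ∃ λ k → Walk G u v k

VSet : ℕ → Set
VSet n = Fin n → Bool

nbrOf : ∀ {n} → Graph n → VSet n → VSet n
nbrOf {n} G S v = any (λ u → S u ∧ adj G u v) (allFin n)

nonEmpty : ∀ {n} → VSet n → Bool
nonEmpty {n} S = any S (allFin n)

-- State of the pruned BFS at the start of the iteration with depth `depth`:
--   vis  : visited vertices
--   lab  : vertices of Q_label at depth `depth`
--   pend : vertices of Q_prune at depth `depth + 1` created in step (iii)
--   out  : depth at which a label (root , depth) was added to L(v), if any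
record BFSState (n : ℕ) : Set where
  constructor mkState
  field
    vis lab pend : VSet n
    depth : ℕ
    out : Fin n → Maybe ℕ
open BFSState public

bfsStep : ∀ {n} → Graph n → (inR : VSet n) → BFSState n → BFSState n
bfsStep G inR (mkState vis lab pend d out) =
  mkState vis2 A' P' (suc d) out'
  where
    newV = λ v → not (vis v) ∧ nbrOf G lab v          -- step (i): newly visited at depth d+1
    A'   = λ v → newV v ∧ not (inR v)                 -- enqueued to Q_label, labelled
    B    = λ v → newV v ∧ inR v                       -- landmarks enqueued to Q_prune
    vis1 = λ v → vis v ∨ newV v
    out' = λ v → if A' v then just (suc d) else out v
    Pn   = λ v → B v ∨ pend v                         -- Q_prune at depth d+1
    P'   = λ v → not (vis1 v) ∧ nbrOf G Pn v          -- step (iii): visited at depth d+2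
    vis2 = λ v → vis1 v ∨ P' v

-- Run the while loop (fuel bounds the number of iterations; n+1 suffices).
bfsLoop : ∀ {n} → Graph n → VSet n → ℕ → BFSState n → BFSState n
bfsLoop G inR zero st = st
bfsLoop G inR (suc f) st =
  if nonEmpty (lab st) then bfsLoop G inR f (bfsStep G inR st) else st

prunedBFS : ∀ {n} → Graph n → VSet n → Fin n → Fin n → Maybe ℕ
prunedBFS {n} G inR s =
  out (bfsLoop G inR (suc n)
        (mkState (λ v → does (v ≟ s)) (λ v → does (v ≟ s)) (λ _ → false) 0 (λ _ → nothing)))

inList : ∀ {n} → List (Fin n) → VSet n
inList rs v = any (λ r → does (r ≟ v)) rs

Labelling : ∀ {n} → Graph n → List (Fin n) → Fin n → List (Fin n × ℕ)
Labelling G rs v =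
  concatMap (λ r → maybe (λ d → (r , d) ∷ []) [] (prunedBFS G (inList rs) r v)) rs

module Submission where

open import Defs hiding (sym)
open import Data.Bool using (Bool; true; false; _∧_; _∨_; not) renaming (_≟_ to _≟ᵇ_)
open import Data.Bool.Properties using (T-≡)
open import Data.Bool.ListAction using (any)
open import Data.Empty using (⊥-elim)
open import Data.Fin using (Fin; toℕ) renaming (_≟_ to _≟ᶠ_)
open import Data.Fin.Properties using (any?; toℕ-injective; injective⇒≤; toℕ<n)
open import Data.List using (List; []; _∷_; allFin)
open import Data.List.Membership.Propositional using (_∈_; find; lose)
open import Data.List.Membership.Propositional.Properties using (∈-allFin; ∈-concatMap⁺)
open import Data.List.Relation.Unary.Any using (here)
open import Data.List.Relation.Unary.Any.Properties using (any⁺; any⁻)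
open import Data.List.Relation.Unary.Unique.Propositional using (Unique)
open import Data.Maybe using (just; nothing; maybe)
open import Data.Nat using (ℕ; zero; suc; _+_; _∸_; _≤_; _<_; _≤?_)
open import Data.Nat.Induction using (<-rec)
open import Data.Nat.Properties
open import Data.Product using (_×_; _,_; ∃; proj₁; proj₂; uncurry)
open import Data.Sum using (_⊎_; inj₁; inj₂; [_,_]′) renaming (map to ⊎-map; map₁ to ⊎-map₁)
open import Function using (_∘_)
open import Function.Bundles using (_⇔_; mk⇔; Equivalence)
open import Relation.Nullary using (¬_; Dec; yes; no; does)
open import Relation.Nullary.Decidable using (_×-dec_; ¬?; dec-true)
open import Relation.Binary.PropositionalEquality using (_≡_; refl; sym; trans; cong; cong₂; subst; module ≡-Reasoning)

open Equivalence using (to; from)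

-- Boolean reflection: the BFS state is Boolean-valued, the invariants are not.

∧-true⁻ : ∀ {a b} → a ∧ b ≡ true → a ≡ true × b ≡ true
∧-true⁻ {true} {true} _ = refl , refl

∧-true⁺ : ∀ {a b} → a ≡ true → b ≡ true → a ∧ b ≡ true
∧-true⁺ refl refl = refl

∨-true⁻ : ∀ {a b} → a ∨ b ≡ true → a ≡ true ⊎ b ≡ true
∨-true⁻ {true} _ = inj₁ refl
∨-true⁻ {false} b = inj₂ b

∨-true⁺ˡ : ∀ {a b} → a ≡ true → a ∨ b ≡ true
∨-true⁺ˡ refl = refl

∨-true⁺ʳ : ∀ {a b} → b ≡ true → a ∨ b ≡ true
∨-true⁺ʳ {true} _ = refl
∨-true⁺ʳ {false} b = b

not-true⁻ : ∀ {a} → not a ≡ true → ¬ (a ≡ true)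
not-true⁻ {false} _ ()

not-true⁺ : ∀ {a} → ¬ (a ≡ true) → not a ≡ true
not-true⁺ {true} a≢true = ⊥-elim (a≢true refl)
not-true⁺ {false} _ = refl

any-true⁻ : ∀ {A : Set} (p : A → Bool) xs → any p xs ≡ true → ∃ λ x → x ∈ xs × p x ≡ true
any-true⁻ p xs e with find (any⁻ p xs (from T-≡ e))
... | x , x∈xs , px = x , x∈xs , to T-≡ px

any-true⁺ : ∀ {A : Set} (p : A → Bool) {x xs} → x ∈ xs → p x ≡ true → any p xs ≡ true
any-true⁺ p x∈xs px = to T-≡ (any⁺ p (lose x∈xs (from T-≡ px)))

does-true⁻ : ∀ {A : Set} (a? : Dec A) → does a? ≡ true → A
does-true⁻ (yes a) _ = a

nbrOf⁻ : ∀ {n} (G : Graph n) S v → nbrOf G S v ≡ true → ∃ λ u → S u ≡ true × adj G u v ≡ true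
nbrOf⁻ {n} G S v e with any-true⁻ _ (allFin n) e
... | u , _ , Su∧uv = u , ∧-true⁻ Su∧uv

nbrOf⁺ : ∀ {n} (G : Graph n) S v u → S u ≡ true → adj G u v ≡ true → nbrOf G S v ≡ true
nbrOf⁺ G S v u Su uv = any-true⁺ _ (∈-allFin u) (∧-true⁺ Su uv)

nonEmpty⁺ : ∀ {n} (S : VSet n) u → S u ≡ true → nonEmpty S ≡ true
nonEmpty⁺ S u Su = any-true⁺ S (∈-allFin u) Su

inList⁻ : ∀ {n} (rs : List (Fin n)) y → inList rs y ≡ true → y ∈ rs
inList⁻ rs y e with any-true⁻ _ rs e
... | x , x∈rs , x≟y with does-true⁻ (x ≟ᶠ y) x≟y
... | refl = x∈rs

inList⁺ : ∀ {n} (rs : List (Fin n)) y → y ∈ rs → inList rs y ≡ true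
inList⁺ rs y y∈rs = any-true⁺ _ y∈rs (dec-true (y ≟ᶠ y) refl)

least-witness : ∀ {P : ℕ → Set} → (∀ k → Dec (P k)) →
  ∀ k → P k → ∃ λ m → P m × (∀ m′ → P m′ → m ≤ m′)
least-witness {P} P? = <-rec _ search
  where
  search : ∀ k → (∀ {j} → j < k → P j → ∃ λ m → P m × (∀ m′ → P m′ → m ≤ m′)) →
    P k → ∃ λ m → P m × (∀ m′ → P m′ → m ≤ m′)
  search k smaller Pk with anyUpTo? P? k
  ... | yes (j , j<k , Pj) = smaller j<k Pj
  ... | no none = k , Pk , λ m′ Pm′ → ≮⇒≥ (λ m′<k → none (m′ , m′<k , Pm′))

+-squeeze : ∀ {x y k m} → x ≤ k → y ≤ m → k + m ≤ x + y → x ≡ k × y ≡ m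
+-squeeze {x} {y} {k} {m} x≤k y≤m k+m≤x+y =
  ≤-antisym x≤k (+-cancelʳ-≤ m k x (≤-trans k+m≤x+y (+-monoʳ-≤ x y≤m))) ,
  ≤-antisym y≤m (+-cancelˡ-≤ k m y (≤-trans k+m≤x+y (+-monoˡ-≤ y x≤k)))

≤-suc-split : ∀ {a d} → a ≤ suc d → a ≤ d ⊎ a ≡ suc d
≤-suc-split = ⊎-map₁ ≤-pred ∘ m≤n⇒m<n∨m≡n

≡suc⇒≰ : ∀ {a d} → a ≡ suc d → ¬ (a ≤ d)
≡suc⇒≰ a≡1+d = <⇒≱ (≤-reflexive (sym a≡1+d))

module Distance {n : ℕ} (G : Graph n) (conn : Connected G) where

  walk-++ : ∀ {u w v a b} → Walk G u w a → Walk G w v b → Walk G u v (a + b)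
  walk-++ here q = q
  walk-++ (step e p) q = step e (walk-++ p q)

  walk-split : ∀ a {b u v} → Walk G u v (a + b) → ∃ λ w → Walk G u w a × Walk G w v b
  walk-split zero p = _ , here , p
  walk-split (suc a) (step e p) with walk-split a p
  ... | w , p₁ , p₂ = w , step e p₁ , p₂

  walk-zero : ∀ {u v} → Walk G u v 0 → u ≡ v
  walk-zero here = refl

  walk-one : ∀ {u v} → Walk G u v 1 → adj G u v ≡ true
  walk-one (step e here) = e

  walk? : ∀ k u v → Dec (Walk G u v k)
  walk? zero u v with u ≟ᶠ v
  ... | yes refl = yes here
  ... | no u≢v = no (u≢v ∘ walk-zero)
  walk? (suc k) u v with any? (λ w → (adj G u w ≟ᵇ true) ×-dec walk? k w v)
  ... | yes (w , uw , p) = yes (step uw p)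
  ... | no none = no λ { (step uw p) → none (_ , uw , p) }

  shortest-walk : ∀ u v → ∃ λ k → IsDist G u v k
  shortest-walk u v = least-witness (λ k → walk? k u v) _ (proj₂ (conn u v))

  -- Kept opaque: the distance is used only through its defining property, and
  -- unfolding the search would make type checking evaluate it.
  opaque
    δ : Fin n → Fin n → ℕ
    δ u v = proj₁ (shortest-walk u v)

    δ-isDist : ∀ u v → IsDist G u v (δ u v)
    δ-isDist u v = proj₂ (shortest-walk u v)

  δ-walk : ∀ u v → Walk G u v (δ u v)
  δ-walk u v = proj₁ (δ-isDist u v)

  δ-minimal : ∀ {u v k} → Walk G u v k → δ u v ≤ k
  δ-minimal {u} {v} p = proj₂ (δ-isDist u v) _ p

  δ-triangle : ∀ a b c → δ a c ≤ δ a b + δ b c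
  δ-triangle a b c = δ-minimal (walk-++ (δ-walk a b) (δ-walk b c))

  δ-refl : ∀ u → δ u u ≡ 0
  δ-refl u = n≤0⇒n≡0 (δ-minimal here)

  δ-zero : ∀ {u v} → δ u v ≡ 0 → u ≡ v
  δ-zero {u} {v} uv≡0 = walk-zero (subst (Walk G u v) uv≡0 (δ-walk u v))

  δ-edge : ∀ a {u v} → adj G u v ≡ true → δ a v ≤ suc (δ a u)
  δ-edge a {u} {v} uv = begin
    δ a v          ≤⟨ δ-triangle a u v ⟩
    δ a u + δ u v  ≤⟨ +-monoʳ-≤ (δ a u) (δ-minimal (step uv here)) ⟩
    δ a u + 1      ≡⟨ +-comm (δ a u) 1 ⟩
    suc (δ a u)    ∎
    where open ≤-Reasoning

  δ-split : ∀ k m {a v} → δ a v ≡ k + m → ∃ λ u → δ a u ≡ k × δ u v ≡ m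
  δ-split k m {a} {v} av≡k+m with walk-split k (subst (Walk G a v) av≡k+m (δ-walk a v))
  ... | u , p , q = u , +-squeeze (δ-minimal p) (δ-minimal q) k+m≤
    where
    k+m≤ : k + m ≤ δ a u + δ u v
    k+m≤ = subst (_≤ δ a u + δ u v) av≡k+m (δ-triangle a u v)

  parent : ∀ {a v k} → δ a v ≡ suc k → ∃ λ u → adj G u v ≡ true × δ a u ≡ k
  parent {a} {v} {k} av≡1+k with δ-split k 1 (trans av≡1+k (+-comm 1 k))
  ... | u , au≡k , uv≡1 = u , walk-one (subst (Walk G u v) uv≡1 (δ-walk u v)) , au≡k

  OnShortestPath : Fin n → Fin n → Fin n → Set
  OnShortestPath a u v = δ a u + δ u v ≡ δ a v

  onSP-≤ : ∀ {a u v} → δ a u + δ u v ≤ δ a v → OnShortestPath a u v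
  onSP-≤ {a} {u} {v} le = ≤-antisym le (δ-triangle a u v)

  onSP-source : ∀ a v → OnShortestPath a a v
  onSP-source a v = cong (_+ δ a v) (δ-refl a)

  ancestor : ∀ {a v k} → k ≤ δ a v → ∃ λ u → δ a u ≡ k × OnShortestPath a u v
  ancestor {a} {v} {k} k≤av with δ-split k (δ a v ∸ k) (sym (m+[n∸m]≡n k≤av))
  ... | u , au≡k , uv≡ = u , au≡k , trans (cong₂ _+_ au≡k uv≡) (m+[n∸m]≡n k≤av)

  -- Distances are smaller than the number of vertices: the vertices at depths
  -- 0 … δ a v of a shortest path are pairwise distinct.
  δ<n : ∀ a v → δ a v < n
  δ<n a v = injective⇒≤ {f = at-depth} injective
    where
    at-depth : Fin (suc (δ a v)) → Fin n
    at-depth i = proj₁ (ancestor {a} {v} (≤-pred (toℕ<n i)))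
    depth-of : ∀ i → δ a (at-depth i) ≡ toℕ i
    depth-of i = proj₁ (proj₂ (ancestor {a} {v} (≤-pred (toℕ<n i))))
    injective : ∀ {i j} → at-depth i ≡ at-depth j → i ≡ j
    injective {i} {j} same = toℕ-injective (trans (sym (depth-of i)) (trans (cong (δ a) same) (depth-of j)))

  onSP-trans-left : ∀ {a y u v} → OnShortestPath a y u → OnShortestPath a u v → OnShortestPath a y v
  onSP-trans-left {a} {y} {u} {v} ayu auv = onSP-≤ (begin
    δ a y + δ y v            ≤⟨ +-monoʳ-≤ (δ a y) (δ-triangle y u v) ⟩
    δ a y + (δ y u + δ u v)  ≡⟨ sym (+-assoc (δ a y) (δ y u) (δ u v)) ⟩
    (δ a y + δ y u) + δ u v  ≡⟨ cong (_+ δ u v) ayu ⟩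
    δ a u + δ u v            ≡⟨ auv ⟩
    δ a v                    ∎)
    where open ≤-Reasoning

  onSP-trans-right : ∀ {a x y v} → OnShortestPath a x v → OnShortestPath x y v → OnShortestPath a y v
  onSP-trans-right {a} {x} {y} {v} axv xyv = onSP-≤ (begin
    δ a y + δ y v            ≤⟨ +-monoˡ-≤ (δ y v) (δ-triangle a x y) ⟩
    (δ a x + δ x y) + δ y v  ≡⟨ +-assoc (δ a x) (δ x y) (δ y v) ⟩
    δ a x + (δ x y + δ y v)  ≡⟨ cong (δ a x +_) xyv ⟩
    δ a x + δ x v            ≡⟨ axv ⟩
    δ a v                    ∎)
    where open ≤-Reasoning

module Shadowing {n : ℕ} (G : Graph n) (conn : Connected G) (inR : VSet n) where
  open Distance G conn

  -- v is shadowed from the root s: a landmark other than s lies on a shortest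
  -- s–v path, so the pruned BFS from s reaches v only through Q_prune.
  Shadowed : Fin n → Fin n → Set
  Shadowed s v = ∃ λ y → inR y ≡ true × ¬ (y ≡ s) × OnShortestPath s y v

  shadowed? : ∀ s v → Dec (Shadowed s v)
  shadowed? s v = any? (λ y → (inR y ≟ᵇ true) ×-dec (¬? (y ≟ᶠ s) ×-dec (δ s y + δ y v ≟ δ s v)))

  root-unshadowed : ∀ s → ¬ Shadowed s s
  root-unshadowed s (y , _ , y≢s , sys) =
    y≢s (sym (δ-zero (m+n≡0⇒m≡0 (δ s y) (trans sys (δ-refl s)))))

  landmark-shadowed : ∀ {s v k} → δ s v ≡ suc k → inR v ≡ true → Shadowed s v
  landmark-shadowed {s} {v} sv≡1+k Rv = v , Rv , v≢s , trans (cong (δ s v +_) (δ-refl v)) (+-identityʳ (δ s v))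
    where
    v≢s : ¬ (v ≡ s)
    v≢s refl = 0≢1+n (trans (sym (δ-refl s)) sv≡1+k)

  shadow-inherit : ∀ {s u v} → OnShortestPath s u v → Shadowed s u → Shadowed s v
  shadow-inherit suv (y , Ry , y≢s , syu) = y , Ry , y≢s , onSP-trans-left syu suv

  unshadowed-ancestor : ∀ {s v k} → ¬ Shadowed s v → k ≤ δ s v → ∃ λ u → δ s u ≡ k × ¬ Shadowed s u
  unshadowed-ancestor ¬sh k≤sv with ancestor k≤sv
  ... | u , su≡k , suv = u , su≡k , ¬sh ∘ shadow-inherit suv

  -- v is entered in step (iii) of round d: it has a shadowed neighbour of depth d.
  Pruned : Fin n → ℕ → Fin n → Set
  Pruned s d v = ∃ λ u → adj G u v ≡ true × δ s u ≡ d × Shadowed s u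

  pruned? : ∀ s d v → Dec (Pruned s d v)
  pruned? s d v = any? (λ u → (adj G u v ≟ᵇ true) ×-dec ((δ s u ≟ d) ×-dec shadowed? s u))

  -- A pruned vertex of depth d + 1 is shadowed: its shadowed neighbour lies on
  -- a shortest path to it.
  pruned⇒shadowed : ∀ {s d v} → δ s v ≡ suc d → Pruned s d v → Shadowed s v
  pruned⇒shadowed {s} {d} {v} sv≡1+d (u , uv , su≡d , sh) = shadow-inherit (onSP-≤ le) sh
    where
    open ≤-Reasoning
    le : δ s u + δ u v ≤ δ s v
    le = begin
      δ s u + δ u v  ≤⟨ +-monoʳ-≤ (δ s u) (δ-minimal (step uv here)) ⟩
      δ s u + 1      ≡⟨ cong (_+ 1) su≡d ⟩
      d + 1          ≡⟨ +-comm d 1 ⟩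
      suc d          ≡⟨ sym sv≡1+d ⟩
      δ s v          ∎

  -- Conversely, a shadowed vertex of depth d + 1 is its own shadowing landmark,
  -- or the last edge of a shortest path from that landmark comes from a
  -- shadowed vertex of depth d.
  shadowed⇒landmark-or-pruned : ∀ {s d v} → δ s v ≡ suc d → Shadowed s v → inR v ≡ true ⊎ Pruned s d v
  shadowed⇒landmark-or-pruned {s} {d} {v} sv≡1+d (y , Ry , y≢s , syv) with δ y v in yv
  ... | zero = inj₁ (subst (λ z → inR z ≡ true) (δ-zero yv) Ry)
  ... | suc m with parent yv
  ...   | w , wv , yw≡m = inj₂ (w , wv , sw≡d , y , Ry , y≢s , trans sy+yw≡d (sym sw≡d))
    where
    sy+yw≡d : δ s y + δ y w ≡ d
    sy+yw≡d = suc-injective (begin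
      suc (δ s y + δ y w)  ≡⟨ cong (λ z → suc (δ s y + z)) yw≡m ⟩
      suc (δ s y + m)      ≡⟨ sym (+-suc (δ s y) m) ⟩
      δ s y + suc m        ≡⟨ syv ⟩
      δ s v                ≡⟨ sv≡1+d ⟩
      suc d                ∎)
      where open ≡-Reasoning
    sw≡d : δ s w ≡ d
    sw≡d = ≤-antisym (subst (δ s w ≤_) sy+yw≡d (δ-triangle s y w))
                     (≤-pred (subst (_≤ suc (δ s w)) sv≡1+d (δ-edge s wv)))

module PrunedBFS {n : ℕ} (G : Graph n) (conn : Connected G) (inR : VSet n) (s : Fin n) where
  open Distance G conn
  open Shadowing G conn inR

  D : Fin n → ℕ
  D = δ s

  record Invariant (d : ℕ) (st : BFSState n) : Set where
    field
      depth≡ : depth st ≡ d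
      visited : ∀ v → vis st v ≡ true ⇔ (D v ≤ d ⊎ (D v ≡ suc d × Pruned s d v))
      labelQueue : ∀ v → lab st v ≡ true ⇔ (D v ≡ d × ¬ Shadowed s v)
      pruneQueue : ∀ v → pend st v ≡ true ⇔ (D v ≡ suc d × Pruned s d v)
      labelled : ∀ v → ¬ Shadowed s v → 1 ≤ D v → D v ≤ d → out st v ≡ just (D v)

  isRoot : VSet n
  isRoot v = does (v ≟ᶠ s)

  initial-state : BFSState n
  initial-state = mkState isRoot isRoot (λ _ → false) 0 (λ _ → nothing)

  isRoot⁻ : ∀ {v} → isRoot v ≡ true → v ≡ s
  isRoot⁻ {v} = does-true⁻ (v ≟ᶠ s)

  isRoot⁺ : ∀ {v} → D v ≡ 0 → isRoot v ≡ true
  isRoot⁺ {v} Dv≡0 = dec-true (v ≟ᶠ s) (sym (δ-zero Dv≡0))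

  -- Nothing is pruned in round 0: the only vertex of depth 0 is the root.
  unpruned₀ : ∀ {v} → ¬ Pruned s 0 v
  unpruned₀ (u , _ , Du≡0 , sh) with δ-zero Du≡0
  ... | refl = root-unshadowed s sh

  invariant-initial : Invariant 0 initial-state
  invariant-initial = record
    { depth≡ = refl
    ; visited = λ v → mk⇔ (λ e → inj₁ (≤-reflexive (depth-of-root e)))
        [ isRoot⁺ ∘ n≤0⇒n≡0 , ⊥-elim ∘ unpruned₀ ∘ proj₂ ]′
    ; labelQueue = λ v → mk⇔ (λ e → depth-of-root e , root-unshadowed s ∘ subst (Shadowed s) (isRoot⁻ e))
        (isRoot⁺ ∘ proj₁)
    ; pruneQueue = λ v → mk⇔ (λ ()) (⊥-elim ∘ unpruned₀ ∘ proj₂)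
    ; labelled = λ v _ 1≤Dv Dv≤0 → ⊥-elim (<⇒≱ 1≤Dv Dv≤0)
    }
    where
    depth-of-root : ∀ {v} → isRoot v ≡ true → D v ≡ 0
    depth-of-root e = trans (cong D (isRoot⁻ e)) (δ-refl s)

  module Round {d : ℕ} (st : BFSState n) (I : Invariant d st) where
    open Invariant I

    next : BFSState n
    next = bfsStep G inR st

    reached : VSet n
    reached v = not (vis st v) ∧ nbrOf G (lab st) v

    reached⁻ : ∀ v → reached v ≡ true → D v ≡ suc d × ¬ Pruned s d v
    reached⁻ v e with ∧-true⁻ {not (vis st v)} e
    ... | unvisited , adjacent with nbrOf⁻ G (lab st) v adjacent
    ...   | u , u∈Q , uv with ≤-suc-split (subst (λ z → D v ≤ suc z) (proj₁ (to (labelQueue u) u∈Q)) (δ-edge s uv))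
    ...     | inj₁ Dv≤d = ⊥-elim (not-true⁻ unvisited (from (visited v) (inj₁ Dv≤d)))
    ...     | inj₂ Dv≡1+d = Dv≡1+d , λ p → not-true⁻ unvisited (from (visited v) (inj₂ (Dv≡1+d , p)))

    reached⁺ : ∀ v → D v ≡ suc d → ¬ Pruned s d v → reached v ≡ true
    reached⁺ v Dv≡1+d ¬p = ∧-true⁺ (not-true⁺ unvisited) adjacent
      where
      unvisited : ¬ (vis st v ≡ true)
      unvisited e = [ ≡suc⇒≰ Dv≡1+d , ¬p ∘ proj₂ ]′ (to (visited v) e)
      adjacent : nbrOf G (lab st) v ≡ true
      adjacent with parent Dv≡1+d
      ... | u , uv , Du≡d = nbrOf⁺ G (lab st) v u (from (labelQueue u) (Du≡d , λ sh → ¬p (u , uv , Du≡d , sh))) uv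

    label⁻ : ∀ v → lab next v ≡ true → D v ≡ suc d × ¬ Shadowed s v
    label⁻ v e with ∧-true⁻ {reached v} e
    ... | r , notLandmark with reached⁻ v r
    ...   | Dv≡1+d , ¬p = Dv≡1+d , [ not-true⁻ notLandmark , ¬p ]′ ∘ shadowed⇒landmark-or-pruned Dv≡1+d

    label⁺ : ∀ v → D v ≡ suc d → ¬ Shadowed s v → lab next v ≡ true
    label⁺ v Dv≡1+d ¬sh = ∧-true⁺ (reached⁺ v Dv≡1+d (¬sh ∘ pruned⇒shadowed Dv≡1+d))
                                  (not-true⁺ (¬sh ∘ landmark-shadowed Dv≡1+d))

    visited₁ : VSet n
    visited₁ v = vis st v ∨ reached v

    visited₁⁻ : ∀ v → visited₁ v ≡ true → D v ≤ suc d
    visited₁⁻ v e with ∨-true⁻ {vis st v} e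
    ... | inj₂ r = ≤-reflexive (proj₁ (reached⁻ v r))
    ... | inj₁ old = [ m≤n⇒m≤1+n , ≤-reflexive ∘ proj₁ ]′ (to (visited v) old)

    visited₁⁺ : ∀ v → D v ≤ suc d → visited₁ v ≡ true
    visited₁⁺ v Dv≤1+d with ≤-suc-split Dv≤1+d | pruned? s d v
    ... | inj₁ Dv≤d | _ = ∨-true⁺ˡ (from (visited v) (inj₁ Dv≤d))
    ... | inj₂ Dv≡1+d | yes p = ∨-true⁺ˡ (from (visited v) (inj₂ (Dv≡1+d , p)))
    ... | inj₂ Dv≡1+d | no ¬p = ∨-true⁺ʳ {vis st v} (reached⁺ v Dv≡1+d ¬p)

    pruneQueue₁ : VSet n
    pruneQueue₁ v = (reached v ∧ inR v) ∨ pend st v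

    pruneQueue₁⁻ : ∀ v → pruneQueue₁ v ≡ true → D v ≡ suc d × Shadowed s v
    pruneQueue₁⁻ v e with ∨-true⁻ {reached v ∧ inR v} e
    ... | inj₁ r∧R with ∧-true⁻ {reached v} r∧R
    ...   | r , R = let Dv≡1+d = proj₁ (reached⁻ v r) in Dv≡1+d , landmark-shadowed Dv≡1+d R
    pruneQueue₁⁻ v e | inj₂ pending with to (pruneQueue v) pending
    ...   | Dv≡1+d , p = Dv≡1+d , pruned⇒shadowed Dv≡1+d p

    pruneQueue₁⁺ : ∀ v → D v ≡ suc d → Shadowed s v → pruneQueue₁ v ≡ true
    pruneQueue₁⁺ v Dv≡1+d sh with pruned? s d v
    ... | yes p = ∨-true⁺ʳ {reached v ∧ inR v} (from (pruneQueue v) (Dv≡1+d , p))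
    ... | no ¬p = ∨-true⁺ˡ (∧-true⁺ (reached⁺ v Dv≡1+d ¬p) landmark)
      where
      landmark : inR v ≡ true
      landmark = [ (λ R → R) , ⊥-elim ∘ ¬p ]′ (shadowed⇒landmark-or-pruned Dv≡1+d sh)

    pend⁻ : ∀ v → pend next v ≡ true → D v ≡ suc (suc d) × Pruned s (suc d) v
    pend⁻ v e with ∧-true⁻ {not (visited₁ v)} e
    ... | unvisited , adjacent with nbrOf⁻ G pruneQueue₁ v adjacent
    ...   | u , u∈P , uv with pruneQueue₁⁻ u u∈P
    ...     | Du≡1+d , sh with ≤-suc-split (subst (λ z → D v ≤ suc z) Du≡1+d (δ-edge s uv))
    ...       | inj₁ Dv≤1+d = ⊥-elim (not-true⁻ unvisited (visited₁⁺ v Dv≤1+d))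
    ...       | inj₂ Dv≡2+d = Dv≡2+d , u , uv , Du≡1+d , sh

    pend⁺ : ∀ v → D v ≡ suc (suc d) → Pruned s (suc d) v → pend next v ≡ true
    pend⁺ v Dv≡2+d (u , uv , Du≡1+d , sh) =
      ∧-true⁺ (not-true⁺ (≡suc⇒≰ Dv≡2+d ∘ visited₁⁻ v))
              (nbrOf⁺ G pruneQueue₁ v u (pruneQueue₁⁺ u Du≡1+d sh) uv)

    labelled-next : ∀ v → ¬ Shadowed s v → 1 ≤ D v → D v ≤ suc d → out next v ≡ just (D v)
    labelled-next v ¬sh 1≤Dv Dv≤1+d with lab next v in new
    ... | true = cong just (trans (cong suc depth≡) (sym (proj₁ (label⁻ v new))))
    ... | false with ≤-suc-split Dv≤1+d
    ...   | inj₁ Dv≤d = labelled v ¬sh 1≤Dv Dv≤d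
    ...   | inj₂ Dv≡1+d with trans (sym new) (label⁺ v Dv≡1+d ¬sh)
    ...     | ()

    invariant-next : Invariant (suc d) next
    invariant-next = record
      { depth≡ = cong suc depth≡
      ; visited = λ v → mk⇔ (⊎-map (visited₁⁻ v) (pend⁻ v) ∘ ∨-true⁻ {visited₁ v})
          [ ∨-true⁺ˡ ∘ visited₁⁺ v , ∨-true⁺ʳ {visited₁ v} ∘ uncurry (pend⁺ v) ]′
      ; labelQueue = λ v → mk⇔ (label⁻ v) (uncurry (label⁺ v))
      ; pruneQueue = λ v → mk⇔ (pend⁻ v) (uncurry (pend⁺ v))
      ; labelled = labelled-next
      }

  open Invariant using (labelQueue; labelled)

  -- While an unshadowed vertex lies at depth ≥ d, Q_label is non-empty in
  -- round d: it contains the unshadowed vertex of depth d on a shortest path.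
  queue-nonempty : ∀ {d st v} → Invariant d st → ¬ Shadowed s v → d ≤ D v → nonEmpty (lab st) ≡ true
  queue-nonempty {st = st} I ¬sh d≤Dv with unshadowed-ancestor ¬sh d≤Dv
  ... | u , Du≡d , ¬shu = nonEmpty⁺ (lab st) u (from (labelQueue I u) (Du≡d , ¬shu))

  -- Running the loop from round d with enough fuel labels every unshadowed
  -- vertex v ≠ s; the loop cannot stop early because of queue-nonempty.
  loop-labels : ∀ {v} → ¬ Shadowed s v → 1 ≤ D v →
    ∀ fuel d st → Invariant d st → D v ≤ d + fuel → out (bfsLoop G inR fuel st) v ≡ just (D v)
  loop-labels {v} ¬sh 1≤Dv zero d st I Dv≤d+0 = labelled I v ¬sh 1≤Dv (subst (D v ≤_) (+-identityʳ d) Dv≤d+0)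
  loop-labels {v} ¬sh 1≤Dv (suc fuel) d st I Dv≤ with nonEmpty (lab st) in nonempty
  ... | true = loop-labels ¬sh 1≤Dv fuel (suc d) (Round.next st I) (Round.invariant-next st I)
                 (subst (D v ≤_) (+-suc d fuel) Dv≤)
  ... | false with D v ≤? d
  ...   | yes Dv≤d = labelled I v ¬sh 1≤Dv Dv≤d
  ...   | no Dv≰d with trans (sym nonempty) (queue-nonempty I ¬sh (<⇒≤ (≰⇒> Dv≰d)))
  ...     | ()

  -- Lemma (labels of the pruned BFS): every unshadowed vertex v ≠ s receives
  -- the label (s , d(s,v)).  Fuel n + 1 suffices since depths are below n.
  pruned-bfs-labels : ∀ {v} → ¬ Shadowed s v → ¬ (v ≡ s) → prunedBFS G inR s v ≡ just (D v)
  pruned-bfs-labels {v} ¬sh v≢s =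
    loop-labels ¬sh (n≢0⇒n>0 (v≢s ∘ sym ∘ δ-zero)) (suc n) 0 initial-state invariant-initial
      (m≤n⇒m≤1+n (<⇒≤ (δ<n s v)))

labelling-entry : ∀ {n} (G : Graph n) (rs : List (Fin n)) {r v k} → r ∈ rs →
  prunedBFS G (inList rs) r v ≡ just k → (r , k) ∈ Labelling G rs v
labelling-entry G rs {r} {v} {k} r∈rs bfs≡k =
  ∈-concatMap⁺ entries (lose r∈rs (subst (λ found → (r , k) ∈ maybe (λ d → (r , d) ∷ []) [] found) (sym bfs≡k) (here refl)))
  where
  entries : Fin _ → List (Fin _ × ℕ)
  entries r′ = maybe (λ d → (r′ , d) ∷ []) [] (prunedBFS G (inList rs) r′ v)

module Closest {n : ℕ} (G : Graph n) (conn : Connected G) (inR : VSet n) where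
  open Distance G conn
  open Shadowing G conn inR

  Candidate : Fin n → Fin n → ℕ → Set
  Candidate r v k = ∃ λ x → inR x ≡ true × OnShortestPath r x v × δ x v ≡ k

  candidate? : ∀ r v k → Dec (Candidate r v k)
  candidate? r v k = any? (λ x → (inR x ≟ᵇ true) ×-dec ((δ r x + δ x v ≟ δ r v) ×-dec (δ x v ≟ k)))

  -- A landmark x on a shortest r–v path that is closest to v does not see v
  -- shadowed: a shadowing landmark y ≠ x would also lie on a shortest r–v
  -- path, strictly closer to v.
  closest-landmark : ∀ r v → inR r ≡ true → ∃ λ x → inR x ≡ true × OnShortestPath r x v × ¬ Shadowed x v
  closest-landmark r v Rr with least-witness (candidate? r v) (δ r v) (r , Rr , onSP-source r v , refl)
  ... | k , (x , Rx , rxv , xv≡k) , minimal = x , Rx , rxv , unshadowed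
    where
    unshadowed : ¬ Shadowed x v
    unshadowed (y , Ry , y≢x , xyv) =
      <⇒≱ closer (minimal (δ y v) (y , Ry , onSP-trans-right rxv xyv , refl))
      where
      closer : δ y v < k
      closer = begin-strict
        δ y v          <⟨ m<n+m (δ y v) (n≢0⇒n>0 (y≢x ∘ sym ∘ δ-zero)) ⟩
        δ x y + δ y v  ≡⟨ xyv ⟩
        δ x v          ≡⟨ xv≡k ⟩
        k              ∎
        where open ≤-Reasoning

-- Corollary 3.8.  The closest landmark x on a shortest r–v path labels v with
-- (x , d(x,v)), and d(r,v) = d(x,v) + d(r,x) because x lies on that path.
corollary3p8 : ∀ {n} (G : Graph n) (rs : List (Fin n)) → Unique rs → Connected G →
    ∀ (r v : Fin n) → r ∈ rs → ¬ (v ∈ rs) →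
    ¬ (∃ λ k → (r , k) ∈ Labelling G rs v) →
    ∃ λ rj → ∃ λ k → rj ∈ rs × (rj , k) ∈ Labelling G rs v ×
      ∃ λ d → IsDist G r rj d × IsDist G r v (k + d)
corollary3p8 G rs _ conn r v r∈rs v∉rs _
  with Closest.closest-landmark G conn (inList rs) r v (inList⁺ rs r r∈rs)
... | x , Rx , rxv , ¬sh =
  x , δ x v , x∈rs , labelling-entry G rs x∈rs (PrunedBFS.pruned-bfs-labels G conn (inList rs) x ¬sh v≢x) ,
  δ r x , δ-isDist r x , subst (IsDist G r v) (trans (sym rxv) (+-comm (δ r x) (δ x v))) (δ-isDist r v)
  where
  open Distance G conn
  x∈rs : x ∈ rs
  x∈rs = inList⁻ rs x Rx
  v≢x : ¬ (v ≡ x)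
  v≢x v≡x = v∉rs (subst (_∈ rs) (sym v≡x) x∈rs)
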